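{- If two operation sequences $u$ and $v$ produce the same permutation $\pi$ and both output eagerly, then $u$ and $v$ have the same type. Moreover, for each $i$, the $i$th operation of $u$ moves the same item as the $i$th operation of $v$.
   Context: A deque has a top end and a bottom end. On input $1,2,\dots,n$, the operations are $I_1$/$I_2$ (move the next input element to the top/bottom end of the deque) and $O_1$/$O_2$ (remove the top/bottom element and append it to the output). An operation sequence is a word over $\{I_1,I_2,O_1,O_2\}$ with equally many $I$ and $O$ letters in total and every prefix having at least as many $I$ letters as $O$ letters; it produces the permutation read off the output. An operation sequence outputs eagerly if it contains no contiguous factor $I_1O_2$ or $I_2O_1$. The type of an operation sequence is the word over $\{I,O\}$ obtained by deleting all subscripts. -}

module Defs where

open import Data.Nat using (ℕ; zero; suc; _≤_)
open import Data.List using (List; []; _∷_; _++_; take; length; filter)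
open import Data.Maybe using (Maybe; just; nothing)
open import Data.Product using (_×_; _,_; ∃-syntax)
open import Relation.Nullary using (¬_)
open import Relation.Binary.PropositionalEquality using (_≡_)

-- The four deque operations.  Deque stored as a list: head = top end,
-- last element = bottom end.
data Op : Set where
  I₁ I₂ O₁ O₂ : Op

data IO : Set where
  I O : IO

typeOf : Op → IO
typeOf I₁ = I
typeOf I₂ = I
typeOf O₁ = O
typeOf O₂ = O

type : List Op → List IO
type [] = []
type (x ∷ w) = typeOf x ∷ type w

#I : List Op → ℕ
#I [] = 0
#I (I₁ ∷ w) = suc (#I w)
#I (I₂ ∷ w) = suc (#I w)
#I (O₁ ∷ w) = #I w
#I (O₂ ∷ w) = #I w

#O : List Op → ℕ
#O [] = 0
#O (I₁ ∷ w) = #O w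
#O (I₂ ∷ w) = #O w
#O (O₁ ∷ w) = suc (#O w)
#O (O₂ ∷ w) = suc (#O w)

record IsOpSeq (w : List Op) : Set where
  field
    balanced : #I w ≡ #O w
    prefixes : ∀ k → #O (take k w) ≤ #I (take k w)

Eager : List Op → Set
Eager w = (¬ (∃[ xs ] ∃[ ys ] w ≡ xs ++ I₁ ∷ O₂ ∷ ys))
        × (¬ (∃[ xs ] ∃[ ys ] w ≡ xs ++ I₂ ∷ O₁ ∷ ys))

unsnoc : List ℕ → Maybe (List ℕ × ℕ)
unsnoc [] = nothing
unsnoc (x ∷ []) = just ([] , x)
unsnoc (x ∷ y ∷ d) with unsnoc (y ∷ d)
... | nothing = nothing
... | just (d' , z) = just (x ∷ d' , z)

-- Run the operations with next input element `next` and current deque.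
-- Returns (item moved by each operation, in order ; output word),
-- or nothing if an O is applied to an empty deque.
run : ℕ → List ℕ → List Op → Maybe (List ℕ × List ℕ)
run next d [] = just ([] , [])
run next d (I₁ ∷ w) with run (suc next) (next ∷ d) w
... | nothing = nothing
... | just (ms , out) = just (next ∷ ms , out)
run next d (I₂ ∷ w) with run (suc next) (d ++ next ∷ []) w
... | nothing = nothing
... | just (ms , out) = just (next ∷ ms , out)
run next [] (O₁ ∷ w) = nothing
run next (x ∷ d) (O₁ ∷ w) with run next d w
... | nothing = nothing
... | just (ms , out) = just (x ∷ ms , x ∷ out)
run next d (O₂ ∷ w) with unsnoc d
... | nothing = nothing
... | just (d' , x) with run next d' w
...   | nothing = nothing
...   | just (ms , out) = just (x ∷ ms , x ∷ out)

-- input is 1,2,…,n ; deque starts empty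
-- `Runs w ms π`: running w moves item ms[i] at step i and outputs π
Runs : List Op → List ℕ → List ℕ → Set
Runs w ms π = run 1 [] w ≡ just (ms , π)

Produces : List Op → List ℕ → Set
Produces w π = ∃[ ms ] Runs w ms π

-- Keep the invariant that the deque holds only items below the next input c. An output step then
-- emits an item below c, whereas in an eager sequence an input step is never followed by an output
-- below c. So the common output decides, step by step, whether both sequences input (moving c) or
-- both output (moving the same output item); balance makes them end together.
module Submission where

open import Defs
open import Data.List using (List; []; _∷_; _++_; [_]; length)
open import Data.List.Relation.Unary.All using (All; []; _∷_) renaming (map to All-map)
open import Data.List.Relation.Unary.All.Properties using (++⁺)
open import Data.Maybe using (Maybe; just; nothing)
open import Data.Nat using (ℕ; suc; _+_; _≤_; _<_)
open import Data.Nat.Properties using (≤-refl; <⇒≤; ≤-reflexive; m<n⇒m<1+n; <⇒≱; suc-injective; +-suc)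
open import Data.Product using (_×_; _,_; proj₁; proj₂; ∃-syntax)
open import Data.Empty using (⊥-elim)
open import Relation.Binary.PropositionalEquality using (_≡_; refl; cong; sym; trans)

data End : Set where
  top bottom : End

end : Op → End
end I₁ = top
end I₂ = bottom
end O₁ = top
end O₂ = bottom

push : End → ℕ → List ℕ → List ℕ
push top    x d = x ∷ d
push bottom x d = d ++ [ x ]

pop : End → List ℕ → Maybe (List ℕ × ℕ)
pop top []      = nothing
pop top (x ∷ d) = just (d , x)
pop bottom d    = unsnoc d

pop-push : ∀ e x d → pop e (push e x d) ≡ just (d , x)
pop-push top    x d = refl
pop-push bottom x [] = refl
pop-push bottom x (y ∷ []) = refl
pop-push bottom x (y ∷ z ∷ d) rewrite pop-push bottom x (z ∷ d) = refl

pop-push-item : ∀ {e e′ x d d′ y} → e ≡ e′ → pop e′ (push e x d) ≡ just (d′ , y) → y ≡ x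
pop-push-item {e} {x = x} {d} refl popped with refl ← trans (sym (pop-push e x d)) popped = refl

Below : ℕ → List ℕ → Set
Below c = All (_< c)

push-Below : ∀ e {c d} → Below c d → Below (suc c) (push e c d)
push-Below top    below = ≤-refl ∷ All-map m<n⇒m<1+n below
push-Below bottom below = ++⁺ (All-map m<n⇒m<1+n below) (≤-refl ∷ [])

pop-Below : ∀ e {c d d′ x} → Below c d → pop e d ≡ just (d′ , x) → Below c d′ × x < c
pop-Below top    (p ∷ ps) refl = ps , p
pop-Below bottom {d = x ∷ []} (p ∷ []) refl = [] , p
pop-Below bottom {d = x ∷ y ∷ d} (p ∷ ps) eq with unsnoc (y ∷ d) in e | eq
... | just _ | refl with pop-Below bottom ps e
...   | ps′ , q = p ∷ ps′ , q

eager-tail : ∀ {x w} → Eager (x ∷ w) → Eager w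
eager-tail {x} (no₁₂ , no₂₁) =
  (λ (xs , ys , eq) → no₁₂ (x ∷ xs , ys , cong (x ∷_) eq)) ,
  (λ (xs , ys , eq) → no₂₁ (x ∷ xs , ys , cong (x ∷_) eq))

eager-same-end : ∀ {i o w} → Eager (i ∷ o ∷ w) → typeOf i ≡ I → typeOf o ≡ O → end i ≡ end o
eager-same-end {I₁} {O₁} eager refl refl = refl
eager-same-end {I₁} {O₂} {w} (no₁₂ , _) refl refl with () ← no₁₂ ([] , w , refl)
eager-same-end {I₂} {O₁} {w} (_ , no₂₁) refl refl with () ← no₂₁ ([] , w , refl)
eager-same-end {I₂} {O₂} eager refl refl = refl

run-input : ∀ i {c d w ms out} → typeOf i ≡ I → run c d (i ∷ w) ≡ just (ms , out) →
  ∃[ ms′ ] run (suc c) (push (end i) c d) w ≡ just (ms′ , out) × ms ≡ c ∷ ms′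
run-input I₁ {c} {d} {w} refl eq with run (suc c) (c ∷ d) w | eq
... | just (ms′ , _) | refl = ms′ , refl , refl
run-input I₂ {c} {d} {w} refl eq with run (suc c) (d ++ [ c ]) w | eq
... | just (ms′ , _) | refl = ms′ , refl , refl

run-output : ∀ o {c d w ms out} → typeOf o ≡ O → run c d (o ∷ w) ≡ just (ms , out) →
  ∃[ d′ ] ∃[ x ] ∃[ ms′ ] ∃[ out′ ]
    pop (end o) d ≡ just (d′ , x) × run c d′ w ≡ just (ms′ , out′) × ms ≡ x ∷ ms′ × out ≡ x ∷ out′
run-output O₁ {c} {x ∷ d} {w} refl eq with run c d w in r | eq
... | just (ms′ , out′) | refl = d , x , ms′ , out′ , refl , r , refl , refl
run-output O₂ {c} {d} {w} refl eq with unsnoc d | eq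
... | just (d′ , x) | eq′ with run c d′ w in r | eq′
...   | just (ms′ , out′) | refl = d′ , x , ms′ , out′ , refl , r , refl , refl

#O≡length-output : ∀ w {c d ms out} → run c d w ≡ just (ms , out) → #O w ≡ length out
#O≡length-output [] refl = refl
#O≡length-output (I₁ ∷ w) {c} {d} eq
  with _ , r , _ ← run-input I₁ {c} {d} {w} refl eq = #O≡length-output w r
#O≡length-output (I₂ ∷ w) {c} {d} eq
  with _ , r , _ ← run-input I₂ {c} {d} {w} refl eq = #O≡length-output w r
#O≡length-output (O₁ ∷ w) {c} {d} eq
  with _ , _ , _ , _ , _ , r , _ , refl ← run-output O₁ {c} {d} {w} refl eq = cong suc (#O≡length-output w r)
#O≡length-output (O₂ ∷ w) {c} {d} eq
  with _ , _ , _ , _ , _ , r , _ , refl ← run-output O₂ {c} {d} {w} refl eq = cong suc (#O≡length-output w r)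

length≡#I+#O : ∀ w → length w ≡ #I w + #O w
length≡#I+#O []       = refl
length≡#I+#O (I₁ ∷ w) = cong suc (length≡#I+#O w)
length≡#I+#O (I₂ ∷ w) = cong suc (length≡#I+#O w)
length≡#I+#O (O₁ ∷ w) = trans (cong suc (length≡#I+#O w)) (sym (+-suc (#I w) (#O w)))
length≡#I+#O (O₂ ∷ w) = trans (cong suc (length≡#I+#O w)) (sym (+-suc (#I w) (#O w)))

opSeq-length : ∀ {w ms π} → IsOpSeq w → Runs w ms π → length w ≡ length π + length π
opSeq-length {w} isOpSeq runs
  rewrite length≡#I+#O w | IsOpSeq.balanced isOpSeq | #O≡length-output w runs = refl

-- Eagerness forbids outputting from the other end, so after an input the next output is either
-- the item just input or comes after further, larger inputs.
input-next-output-≥ : ∀ i {c d w ms p out} → typeOf i ≡ I → Eager (i ∷ w) →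
  run c d (i ∷ w) ≡ just (ms , p ∷ out) → c ≤ p
input-next-output-≥ i {w = w} isI eager eq with run-input i isI eq
input-next-output-≥ i {w = []}    isI eager eq | _ , () , _
input-next-output-≥ i {w = j ∷ w} isI eager eq | _ , r , _ with typeOf j in isJ
... | I = <⇒≤ (input-next-output-≥ j isJ (eager-tail eager) r)
... | O with run-output j isJ r
...   | _ , _ , _ , _ , popped , _ , _ , refl =
  ≤-reflexive (sym (pop-push-item (eager-same-end eager isI isJ) popped))

eager-runs-agree : ∀ {c du dv} u v {π mu mv} → Below c du → Below c dv → Eager u → Eager v →
  length u ≡ length v → run c du u ≡ just (mu , π) → run c dv v ≡ just (mv , π) →
  type u ≡ type v × mu ≡ mv
eager-runs-agree []      []      _  _  _  _  _   refl refl = refl , refl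
eager-runs-agree []      (_ ∷ _) _  _  _  _  ()
eager-runs-agree (_ ∷ _) []      _  _  _  _  ()
eager-runs-agree (a ∷ u) (b ∷ v) bu bv eu ev len ru rv with typeOf a in isA | typeOf b in isB
... | I | I
  with _ , ru′ , refl ← run-input a isA ru
     | _ , rv′ , refl ← run-input b isB rv
  with types , moves ← eager-runs-agree u v (push-Below (end a) bu) (push-Below (end b) bv)
                         (eager-tail eu) (eager-tail ev) (suc-injective len) ru′ rv′
  = cong (I ∷_) types , cong (_ ∷_) moves
... | O | O
  with _ , _ , _ , _ , popU , ru′ , refl , refl ← run-output a isA ru
     | _ , _ , _ , _ , popV , rv′ , refl , refl ← run-output b isB rv
  with types , moves ← eager-runs-agree u v
                         (pop-Below (end a) bu popU .proj₁) (pop-Below (end b) bv popV .proj₁)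
                         (eager-tail eu) (eager-tail ev) (suc-injective len) ru′ rv′
  = cong (O ∷_) types , cong (_ ∷_) moves
... | I | O
  with _ , _ , _ , _ , popV , _ , _ , refl ← run-output b isB rv
  = ⊥-elim (<⇒≱ (pop-Below (end b) bv popV .proj₂) (input-next-output-≥ a isA eu ru))
... | O | I
  with _ , _ , _ , _ , popU , _ , _ , refl ← run-output a isA ru
  = ⊥-elim (<⇒≱ (pop-Below (end a) bu popU .proj₂) (input-next-output-≥ b isB ev rv))

mainTheorem7 : (u v : List Op) (π mu mv : List ℕ) →
    IsOpSeq u → IsOpSeq v → Eager u → Eager v →
    Runs u mu π → Runs v mv π →
    type u ≡ type v × mu ≡ mv
mainTheorem7 u v π mu mv isU isV eagerU eagerV runsU runsV =
  eager-runs-agree u v [] [] eagerU eagerV sameLength runsU runsV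
  where
  sameLength : length u ≡ length v
  sameLength = trans (opSeq-length isU runsU) (sym (opSeq-length isV runsV))
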